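{- For a consecutive pattern $\sigma\in\mathcal S_3$ let $F_\sigma(q,x,z)=\sum_{n\ge0}\sum_{\pi\in\mathcal S_n}q^{\mathrm{occ}_\sigma(\pi)}x^{\mathrm{cyc}(\pi)}z^n$. Then $F_{213}(q,x,z)=F_{231}(q,x,z)=F_{312}(q,x,z)$.
   Context: $\mathcal S_n$ is the set of permutations of $[n]$; $\mathcal S_0$ contains only the empty permutation. The standard cycle form writes each cycle starting with its smallest element, cycles listed in decreasing order of smallest elements. $\Psi(\pi)$ is the word obtained by deleting parentheses from the standard cycle form; $\mathrm{cyc}(\pi)$ is the number of cycles. $\mathrm{occ}_\sigma(\pi)$ (cyclic occurrences of the consecutive pattern $\sigma$) is the number of positions $i$ such that $\Psi(\pi)_i,\Psi(\pi)_{i+1},\Psi(\pi)_{i+2}$ lie in the same cycle and are order-isomorphic to $\sigma$. -}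

module Defs where

open import Data.Bool using (Bool; true; false; not; _∧_; if_then_else_)
open import Data.Nat as ℕ using (ℕ; zero; suc; _<ᵇ_; _+_)
open import Data.Fin as Fin using (Fin; toℕ)
open import Data.Fin.Properties using () renaming (_≟_ to _≟ᶠ_)
open import Data.Vec as Vec using (Vec; []; _∷_; lookup; toList)
open import Data.List as List using (List; []; _∷_; [_]; map; concatMap; filter; length; concat; reverse)
open import Data.Bool.ListAction using (all)
open import Data.Nat.ListAction using (sum)
open import Data.Nat.Properties using () renaming (_≟_ to _≟ⁿ_)
open import Relation.Nullary.Decidable using (⌊_⌋; _×-dec_)
import Data.List.Relation.Unary.Unique.DecPropositional as UniqueFin
open import Relation.Binary.PropositionalEquality using (_≡_)

-- A permutation π of [n] is represented in one-line notation by the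
-- vector (π(1),…,π(n)); we use the labels 0,…,n-1 (Fin n) instead of
-- 1,…,n, which is an order-preserving relabelling and hence changes
-- neither cycles nor pattern occurrences.

words : (n m : ℕ) → List (Vec (Fin n) m)
words n zero    = [ [] ]
words n (suc m) = concatMap (λ x → map (x ∷_) (words n m)) (List.allFin n)

S : (n : ℕ) → List (Vec (Fin n) n)
S n = filter (λ w → UniqueFin.unique? _≟ᶠ_ (toList w)) (words n n)

module _ {n : ℕ} (π : Vec (Fin n) n) where

  app : Fin n → Fin n
  app i = lookup π i

  walk : ℕ → Fin n → Fin n → List (Fin n)
  walk zero    s j = []
  walk (suc f) s j = if ⌊ j ≟ᶠ s ⌋ then [] else j ∷ walk f s (app j)

  -- the cycle of π containing i, written starting from i
  -- (a cycle has at most n elements, so fuel n suffices)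
  cycleFrom : Fin n → List (Fin n)
  cycleFrom i = i ∷ walk n i (app i)

  isLeader : Fin n → Bool
  isLeader i = all (λ j → ⌊ toℕ i ℕ.≤? toℕ j ⌋) (cycleFrom i)

  -- standard cycle form: each cycle starts with its smallest element,
  -- cycles listed in decreasing order of their smallest elements
  standardCycles : List (List (Fin n))
  standardCycles = map cycleFrom (List.filterᵇ isLeader (reverse (List.allFin n)))

  Ψ : List (Fin n)
  Ψ = concat standardCycles

  cyc : ℕ
  cyc = length standardCycles

record Pattern3 : Set where
  constructor pat
  field
    s₁ s₂ s₃ : ℕ

orderIso : Pattern3 → ℕ → ℕ → ℕ → Bool
orderIso (pat s₁ s₂ s₃) a b c =
  same a b s₁ s₂ ∧ same a c s₁ s₃ ∧ same b c s₂ s₃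
                 ∧ same b a s₂ s₁ ∧ same c a s₃ s₁ ∧ same c b s₃ s₂
  where
  same : ℕ → ℕ → ℕ → ℕ → Bool
  same x y u v = if x <ᵇ y then u <ᵇ v else not (u <ᵇ v)

windows : {n : ℕ} → Pattern3 → List (Fin n) → ℕ
windows σ (a ∷ rest@(b ∷ c ∷ _)) =
  (if orderIso σ (toℕ a) (toℕ b) (toℕ c) then 1 else 0) + windows σ rest
windows σ _ = 0

-- occ_σ(π): positions i such that Ψ_i, Ψ_{i+1}, Ψ_{i+2} lie in the same
-- cycle and are order-isomorphic to σ.  Since Ψ is the concatenation of
-- the cycles, these are exactly the windows lying inside one cycle.
occ : {n : ℕ} → Pattern3 → Vec (Fin n) n → ℕ
occ σ π = sum (map (windows σ) (standardCycles π))

-- Coefficients of F_σ(q,x,z) = Σ_n Σ_{π∈S_n} q^{occ_σ π} x^{cyc π} z^n :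
-- [q^k x^c z^n] F_σ = #{ π ∈ S_n : occ_σ π = k and cyc π = c }.

coeffF : Pattern3 → (k c n : ℕ) → ℕ
coeffF σ k c n =
  length (filter (λ π → (occ σ π ≟ⁿ k) ×-dec (cyc π ≟ⁿ c)) (S n))

-- equality of formal power series in q, x, z = equality of all coefficients
_≡F_ : Pattern3 → Pattern3 → Set
σ ≡F τ = (k c n : ℕ) → coeffF σ k c n ≡ coeffF τ k c n

p213 p231 p312 : Pattern3
p213 = pat 2 1 3
p231 = pat 2 3 1
p312 = pat 3 1 2

-- Write each cycle of π in standard form (m t₁ … t_k), m its least element. Let φ fix every such m
-- and act on each tail t = t₁ … t_k by an involution M t of its entries. Then φ π φ has the standard
-- cycles (m M t (t₁) … M t (t_k)), hence as many cycles as π, and π ↦ φ π φ is an involution of S_n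
-- as soon as the transformed tail induces M t again. A window starting at m begins with its minimum,
-- so it is an occurrence of none of 213, 231, 312. Taking for M t the reversal of positions turns
-- the occurrences of 213 in the tails into occurrences of 312; taking the reversal of values inside
-- t (i-th smallest entry ↦ i-th largest) turns them into occurrences of 231.

module Submission where

open import Defs
open import Data.Bool.Properties using (∧-commutativeMonoid; T-≡)
open import Algebra.Solver.CommutativeMonoid ∧-commutativeMonoid using (solve; _⊕_; _⊜_)
open import Data.Bool using (Bool; true; false; not; _∧_; if_then_else_; T)
open import Data.Fin as Fin using (Fin; toℕ; fromℕ<)
open import Data.Fin.Properties
  using (toℕ-injective; toℕ<n; toℕ-fromℕ<; toℕ-inject; pigeonhole; ¬∀⟶∃¬-smallest; ≤∧≢⇒<)
  renaming (_≟_ to _≟ᶠ_)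
import Data.Fin.Properties as Finₚ
open import Data.List as List
  using (List; []; _∷_; map; filter; filterᵇ; length; reverse; _++_; _∷ʳ_; concatMap; cartesianProductWith; allFin;
         applyUpTo)
open import Data.List.Properties
  using (map-cong-local; map-∘; length-map; length-reverse; reverse-map; reverse-involutive; reverse-++; unfold-reverse;
         filter-≐; ∷-injectiveʳ)
open import Data.List.Membership.Propositional using (_∈_)
open import Data.List.Membership.Propositional.Properties
  using (∈-map⁺; ∈-map⁻; ∈-filter⁺; ∈-filter⁻; ∈-allFin; ∈-cartesianProductWith⁺; ∈-applyUpTo⁺; ∈-applyUpTo⁻)
open import Data.List.Membership.Propositional.Properties.WithK using (unique∧set⇒bag)
open import Data.List.Relation.Binary.BagAndSetEquality using (_∼[_]_; set; ∼bag⇒↭)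
open import Data.List.Relation.Binary.Permutation.Propositional.Properties using (↭-length)
open import Data.List.Relation.Unary.All as All using (All; []; _∷_)
import Data.List.Relation.Unary.All.Properties as Allₚ
open import Data.List.Relation.Unary.AllPairs as AllPairs using (AllPairs; []; _∷_)
import Data.List.Relation.Unary.AllPairs.Properties as AllPairsₚ
open import Data.List.Relation.Unary.Any using (here; there)
import Data.List.Relation.Unary.Any.Properties as Anyₚ
open import Data.List.Relation.Unary.Unique.Propositional using (Unique)
import Data.List.Relation.Unary.Unique.Propositional.Properties as Uniqueₚ
import Data.List.Relation.Unary.Unique.DecPropositional as UniqueDec
open import Data.Nat using (ℕ; zero; suc; _+_; _*_; _<_; _≤_; _≤?_; _<ᵇ_; s≤s; z≤n; s≤s⁻¹)
open import Data.Nat.DivMod using (_%_; _/_; m≡m%n+[m/n]*n; m%n<n)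
open import Data.Nat.ListAction using (sum)
open import Data.Nat.Properties
  using (suc-injective; +-suc; +-comm; +-assoc; +-identityʳ; *-suc; n<1+n; m≤n⇒∃[o]m+o≡n; ≤-trans; ≤-antisym; m≤n+m;
         <-≤-trans; <-cmp; <⇒≤; ≤⇒≯; <⇒<ᵇ; <ᵇ⇒<; ≤-totalOrder)
  renaming (_≟_ to _≟ⁿ_)
open import Data.List.Extrema ≤-totalOrder using (argmin; argmin-all; f[argmin]≤f[xs])
open import Data.Product using (_×_; _,_; proj₂; ∃-syntax)
open import Data.Vec as Vec using (Vec; []; _∷_; lookup; toList)
open import Data.Vec.Properties using (∷-injective; lookup∘tabulate; tabulate-cong; tabulate∘lookup)
open import Function using (_∘_; id; flip)
open import Function.Bundles using (_⇔_; mk⇔; Equivalence)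
open import Level using (0ℓ)
open import Relation.Binary using (Rel)
open import Relation.Binary.Definitions using (DecidableEquality; Asymmetric; tri<; tri≈; tri>)
open import Relation.Binary.PropositionalEquality
open import Relation.Nullary using (¬_; Dec; does; yes; no; contradiction)
open import Relation.Nullary.Decidable
  using (⌊_⌋; dec-true; dec-false; decidable-stable; ¬?; T?; _×-dec_; toWitness; fromWitness)
open import Relation.Unary using (Pred; Decidable; _≐_)

private variable n : ℕ

-- Relabelling along a list

AllPairs-reverse : ∀ {A : Set} {ℓ} {R : Rel A ℓ} {xs} → AllPairs R xs → AllPairs (flip R) (reverse xs)
AllPairs-reverse [] = []
AllPairs-reverse {R = R} {x ∷ xs} (Rx ∷ Rxs) = subst (AllPairs (flip R)) (sym (unfold-reverse x xs))
  (AllPairsₚ.++⁺ (AllPairs-reverse Rxs) ([] ∷ []) (All.tabulate λ y∈ → All.lookup Rx (Anyₚ.reverse⁻ y∈) ∷ []))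

Unique-reverse : ∀ {A : Set} {xs : List A} → Unique xs → Unique (reverse xs)
Unique-reverse u = AllPairs.map (λ x≢y → x≢y ∘ sym) (AllPairs-reverse u)

module _ {A : Set} (_≟_ : DecidableEquality A) where

  relabel : List A → List A → A → A
  relabel (a ∷ s) (b ∷ r) x = if does (x ≟ a) then b else relabel s r x
  relabel _       _       x = x

  relabel-hit : ∀ a b s r → relabel (a ∷ s) (b ∷ r) a ≡ b
  relabel-hit a b s r rewrite dec-true (a ≟ a) refl = refl

  relabel-skip : ∀ {x a} b s r → x ≢ a → relabel (a ∷ s) (b ∷ r) x ≡ relabel s r x
  relabel-skip {x} {a} b s r x≢a rewrite dec-false (x ≟ a) x≢a = refl

  map-relabel : ∀ {s r} → Unique s → length s ≡ length r → map (relabel s r) s ≡ r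
  map-relabel {[]}    {[]}    _          _  = refl
  map-relabel {a ∷ s} {b ∷ r} (a∉s ∷ u) eq = cong₂ _∷_ (relabel-hit a b s r)
    (trans (map-cong-local (All.map (λ a≢x → relabel-skip b s r (a≢x ∘ sym)) a∉s))
           (map-relabel u (suc-injective eq)))

  relabel-∈ : ∀ {s r x} → Unique s → length s ≡ length r → x ∈ s → relabel s r x ∈ r
  relabel-∈ {s} {r} {x} u eq x∈s = subst (relabel s r x ∈_) (map-relabel u eq) (∈-map⁺ (relabel s r) x∈s)

  relabel-map : ∀ {s x} (f : A → A) → Unique s → x ∈ s → relabel s (map f s) x ≡ f x
  relabel-map {a ∷ s} f _          (here refl) = relabel-hit a (f a) s (map f s)
  relabel-map {a ∷ s} f (a∉s ∷ u) (there x∈s) =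
    trans (relabel-skip (f a) s (map f s) (λ x≡a → All.lookup a∉s x∈s (sym x≡a))) (relabel-map f u x∈s)

  relabel-self : ∀ s x → relabel s s x ≡ x
  relabel-self []      x = refl
  relabel-self (a ∷ s) x with x ≟ a
  ... | yes x≡a = sym x≡a
  ... | no  _   = relabel-self s x

  mirror : List A → A → A
  mirror s = relabel s (reverse s)

  module _ {s : List A} (u : Unique s) where

    map-mirror : map (mirror s) s ≡ reverse s
    map-mirror = map-relabel u (sym (length-reverse s))

    mirror-∈ : ∀ {x} → x ∈ s → mirror s x ∈ s
    mirror-∈ x∈s = Anyₚ.reverse⁻ (relabel-∈ u (sym (length-reverse s)) x∈s)

    map-mirror-reverse : map (mirror s) (reverse s) ≡ s
    map-mirror-reverse = begin
      map (mirror s) (reverse s)   ≡⟨ reverse-map (mirror s) s ⟩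
      reverse (map (mirror s) s)   ≡⟨ cong reverse map-mirror ⟩
      reverse (reverse s)          ≡⟨ reverse-involutive s ⟩
      s                            ∎
      where open ≡-Reasoning

    mirror-reverse : ∀ {x} → x ∈ s → mirror (reverse s) x ≡ mirror s x
    mirror-reverse {x} x∈s = begin
      relabel (reverse s) (reverse (reverse s)) x         ≡⟨ cong (λ r → relabel (reverse s) r x) reverse² ⟩
      relabel (reverse s) (map (mirror s) (reverse s)) x
        ≡⟨ relabel-map (mirror s) (Unique-reverse u) (Anyₚ.reverse⁺ x∈s) ⟩
      mirror s x                                          ∎
      where
      open ≡-Reasoning
      reverse² = trans (reverse-involutive s) (sym map-mirror-reverse)

    mirror-involutive : ∀ {x} → x ∈ s → mirror s (mirror s x) ≡ x
    mirror-involutive {x} x∈s = begin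
      mirror s (mirror s x)                      ≡⟨ relabel-map (mirror s ∘ mirror s) u x∈s ⟨
      relabel s (map (mirror s ∘ mirror s) s) x  ≡⟨ cong (λ r → relabel s r x) map-mirror² ⟩
      relabel s s x                              ≡⟨ relabel-self s x ⟩
      x                                          ∎
      where
      open ≡-Reasoning
      map-mirror² = trans (map-∘ s) (trans (cong (map (mirror s)) map-mirror) map-mirror-reverse)

  module _ {ℓ} {R : Rel A ℓ} (R-asym : Asymmetric R) where

    private
      R⇒≢ : ∀ {x y} → R x y → x ≢ y
      R⇒≢ Rxx refl = R-asym Rxx Rxx

    relabel-monotone : ∀ {ℓ′} {S : Rel A ℓ′} {s r x y} → AllPairs R s → AllPairs S r → length s ≡ length r →
                       x ∈ s → y ∈ s → R x y → S (relabel s r x) (relabel s r y)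
    relabel-monotone {S = S} {a ∷ s} {b ∷ r} (Ra ∷ Rs) (Sb ∷ Ss) eq (here refl) (here refl) Raa =
      contradiction refl (R⇒≢ Raa)
    relabel-monotone {S = S} {a ∷ s} {b ∷ r} (Ra ∷ Rs) (Sb ∷ Ss) eq (here refl) (there y∈s) _ =
      subst₂ S (sym (relabel-hit a b s r)) (sym (relabel-skip b s r (R⇒≢ (All.lookup Ra y∈s) ∘ sym)))
        (All.lookup Sb (relabel-∈ (AllPairs.map R⇒≢ Rs) (suc-injective eq) y∈s))
    relabel-monotone {S = S} {a ∷ s} {b ∷ r} (Ra ∷ Rs) (Sb ∷ Ss) eq (there x∈s) (here refl) Rxa =
      contradiction (All.lookup Ra x∈s) (R-asym Rxa)
    relabel-monotone {S = S} {a ∷ s} {b ∷ r} (Ra ∷ Rs) (Sb ∷ Ss) eq (there x∈s) (there y∈s) Rxy =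
      subst₂ S (sym (relabel-skip b s r (R⇒≢ (All.lookup Ra x∈s) ∘ sym)))
               (sym (relabel-skip b s r (R⇒≢ (All.lookup Ra y∈s) ∘ sym)))
        (relabel-monotone Rs Ss (suc-injective eq) x∈s y∈s Rxy)

    mirror-antitone : ∀ {s x y} → AllPairs R s → x ∈ s → y ∈ s → R x y → R (mirror s y) (mirror s x)
    mirror-antitone {s} Rs = relabel-monotone Rs (AllPairs-reverse Rs) (sym (length-reverse s))

-- Counting permutations

length-unique : ∀ {A : Set} {xs ys : List A} → Unique xs → Unique ys →
                (∀ {x} → x ∈ xs ⇔ x ∈ ys) → length xs ≡ length ys
length-unique u v xs≈ys = ↭-length (∼bag⇒↭ (unique∧set⇒bag u v xs≈ys))

IsPerm : Vec (Fin n) n → Set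
IsPerm π = Unique (toList π)

isPerm? : (π : Vec (Fin n) n) → Dec (IsPerm π)
isPerm? π = UniqueDec.unique? _≟ᶠ_ (toList π)

≢-lookup : ∀ {A : Set} {m} {x : A} (v : Vec A m) → All (x ≢_) (toList v) → ∀ i → x ≢ lookup v i
≢-lookup (y ∷ v) (x≢y ∷ _)   Fin.zero    = x≢y
≢-lookup (y ∷ v) (_   ∷ x∉v) (Fin.suc i) = ≢-lookup v x∉v i

lookup-injective : ∀ {A : Set} {m} (v : Vec A m) → Unique (toList v) → ∀ {i j} → lookup v i ≡ lookup v j → i ≡ j
lookup-injective (x ∷ v) _         {Fin.zero}  {Fin.zero}  _  = refl
lookup-injective (x ∷ v) (x∉v ∷ _) {Fin.zero}  {Fin.suc j} eq = contradiction eq (≢-lookup v x∉v j)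
lookup-injective (x ∷ v) (x∉v ∷ _) {Fin.suc i} {Fin.zero}  eq = contradiction (sym eq) (≢-lookup v x∉v i)
lookup-injective (x ∷ v) (_ ∷ u)   {Fin.suc i} {Fin.suc j} eq = cong Fin.suc (lookup-injective v u eq)

toList-tabulate : ∀ {A : Set} {m} (f : Fin m → A) → toList (Vec.tabulate f) ≡ List.tabulate f
toList-tabulate {m = zero}  f = refl
toList-tabulate {m = suc m} f = cong (f Fin.zero ∷_) (toList-tabulate (f ∘ Fin.suc))

tabulate-isPerm : (h : Fin n → Fin n) → (∀ {x y} → h x ≡ h y → x ≡ y) → IsPerm (Vec.tabulate h)
tabulate-isPerm h h-injective = subst Unique (sym (toList-tabulate h)) (Uniqueₚ.tabulate⁺ h-injective)

concatMap-map≡cartesianProductWith : ∀ {A B C : Set} (f : A → B → C) xs ys →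
  concatMap (λ x → map (f x) ys) xs ≡ cartesianProductWith f xs ys
concatMap-map≡cartesianProductWith f []       ys = refl
concatMap-map≡cartesianProductWith f (x ∷ xs) ys =
  cong (map (f x) ys ++_) (concatMap-map≡cartesianProductWith f xs ys)

∈-words : ∀ n m (v : Vec (Fin n) m) → v ∈ words n m
∈-words n zero    []      = here refl
∈-words n (suc m) (x ∷ v) = subst ((x ∷ v) ∈_) (sym (concatMap-map≡cartesianProductWith _∷_ (allFin n) (words n m)))
  (∈-cartesianProductWith⁺ _∷_ (∈-allFin x) (∈-words n m v))

words-unique : ∀ n m → Unique (words n m)
words-unique n zero    = [] ∷ []
words-unique n (suc m) = subst Unique (sym (concatMap-map≡cartesianProductWith _∷_ (allFin n) (words n m)))
  (Uniqueₚ.cartesianProductWith⁺ _∷_ ∷-injective (Uniqueₚ.allFin⁺ n) (words-unique n m))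

∈S⇒isPerm : ∀ {π : Vec (Fin n) n} → π ∈ S n → IsPerm π
∈S⇒isPerm {n} = proj₂ ∘ ∈-filter⁻ isPerm? {xs = words n n}

isPerm⇒∈S : ∀ {π : Vec (Fin n) n} → IsPerm π → π ∈ S n
isPerm⇒∈S {n} {π} = ∈-filter⁺ isPerm? (∈-words n n π)

S-unique : ∀ n → Unique (S n)
S-unique n = Uniqueₚ.filter⁺ isPerm? (words-unique n n)

module _ {n} (f : Vec (Fin n) n → Vec (Fin n) n)
         (f-isPerm : ∀ {π} → IsPerm π → IsPerm (f π))
         (f-involutive : ∀ {π} → IsPerm π → f (f π) ≡ π) where

  private
    -- f extended by the identity off permutations, so that it is injective on all vectors
    g : Vec (Fin n) n → Vec (Fin n) n
    g π with isPerm? π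
    ... | yes _ = f π
    ... | no  _ = π

    g≡f : ∀ {π} → IsPerm π → g π ≡ f π
    g≡f {π} p with isPerm? π
    ... | yes _ = refl
    ... | no ¬p = contradiction p ¬p

    g≡id : ∀ {π} → ¬ IsPerm π → g π ≡ π
    g≡id {π} ¬p with isPerm? π
    ... | yes p = contradiction p ¬p
    ... | no  _ = refl

    g-involutive : ∀ π → g (g π) ≡ π
    g-involutive π = by-cases (isPerm? π)
      where
      by-cases : Dec (IsPerm π) → g (g π) ≡ π
      by-cases (yes p) = trans (cong g (g≡f p)) (trans (g≡f (f-isPerm p)) (f-involutive p))
      by-cases (no ¬p) = trans (cong g (g≡id ¬p)) (g≡id ¬p)

    g-injective : ∀ {π σ} → g π ≡ g σ → π ≡ σ
    g-injective {π} {σ} eq = trans (sym (g-involutive π)) (trans (cong g eq) (g-involutive σ))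

  count-involution : ∀ {P Q : Pred (Vec (Fin n) n) 0ℓ} (P? : Decidable P) (Q? : Decidable Q) →
    (∀ {π} → IsPerm π → P (f π) ⇔ Q π) → length (filter P? (S n)) ≡ length (filter Q? (S n))
  count-involution {P} P? Q? Pf⇔Q = begin
    length (filter P? (S n))          ≡⟨ length-unique (Uniqueₚ.filter⁺ P? (S-unique n))
                                           (Uniqueₚ.map⁺ g-injective (Uniqueₚ.filter⁺ Q? (S-unique n))) (mk⇔ to from) ⟩
    length (map g (filter Q? (S n)))  ≡⟨ length-map g (filter Q? (S n)) ⟩
    length (filter Q? (S n))          ∎
    where
    open ≡-Reasoning
    to : ∀ {σ} → σ ∈ filter P? (S n) → σ ∈ map g (filter Q? (S n))
    to {σ} σ∈ with σ∈S , Pσ ← ∈-filter⁻ P? σ∈ =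
      subst (_∈ map g (filter Q? (S n))) (trans (g≡f fσ-isPerm) (f-involutive σ-isPerm))
        (∈-map⁺ g (∈-filter⁺ Q? (isPerm⇒∈S fσ-isPerm) Qfσ))
      where
      σ-isPerm  = ∈S⇒isPerm σ∈S
      fσ-isPerm = f-isPerm σ-isPerm
      Qfσ = Equivalence.to (Pf⇔Q fσ-isPerm) (subst P (sym (f-involutive σ-isPerm)) Pσ)
    from : ∀ {σ} → σ ∈ map g (filter Q? (S n)) → σ ∈ filter P? (S n)
    from σ∈ with π , π∈ , refl ← ∈-map⁻ g σ∈ with π∈S , Qπ ← ∈-filter⁻ Q? π∈ =
      subst (_∈ filter P? (S n)) (sym (g≡f π-isPerm))
        (∈-filter⁺ P? (isPerm⇒∈S (f-isPerm π-isPerm)) (Equivalence.from (Pf⇔Q π-isPerm) Qπ))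
      where π-isPerm = ∈S⇒isPerm π∈S

-- Orbits and leaders

walk-applyUpTo : ∀ {n} (π : Vec (Fin n) n) {s} (g : ℕ → Fin n) → (∀ a → g (suc a) ≡ app π (g a)) →
  ∀ {c fuel} → c < fuel → g c ≡ s → (∀ {a} → a < c → g a ≢ s) → walk π fuel s (g 0) ≡ applyUpTo g c
walk-applyUpTo π {s} g g-step {zero} {suc fuel} _ g0≡s _ with g 0 ≟ᶠ s
... | yes _    = refl
... | no g0≢s = contradiction g0≡s g0≢s
walk-applyUpTo π {s} g g-step {suc c} {suc fuel} (s≤s c<fuel) gc≡s g≢s with g 0 ≟ᶠ s
... | yes g0≡s = contradiction g0≡s (g≢s (s≤s z≤n))
... | no  _    = cong (g 0 ∷_) (trans (cong (walk π fuel s) (sym (g-step 0)))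
  (walk-applyUpTo π (λ a → g (suc a)) (λ a → g-step (suc a)) c<fuel gc≡s (λ a<c → g≢s (s≤s a<c))))

module Orbits {n} (π : Vec (Fin n) n) (π-injective : ∀ {x y} → app π x ≡ app π y → x ≡ y) where

  π^ : ℕ → Fin n → Fin n
  π^ zero    x = x
  π^ (suc a) x = app π (π^ a x)

  π^-+ : ∀ a b x → π^ (a + b) x ≡ π^ a (π^ b x)
  π^-+ zero    b x = refl
  π^-+ (suc a) b x = cong (app π) (π^-+ a b x)

  π^-injective : ∀ a {x y} → π^ a x ≡ π^ a y → x ≡ y
  π^-injective zero    eq = eq
  π^-injective (suc a) eq = π^-injective a (π-injective eq)

  π^-* : ∀ {p x} → π^ p x ≡ x → ∀ q → π^ (q * p) x ≡ x
  π^-* {p} {x} _   zero    = refl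
  π^-* {p} {x} ret (suc q) = trans (π^-+ p (q * p) x) (trans (cong (π^ p) (π^-* ret q)) ret)

  π^-return : ∀ {i j x} → i < j → π^ i x ≡ π^ j x → ∃[ d ] suc i + d ≡ j × π^ (suc d) x ≡ x
  π^-return {i} {j} {x} i<j πⁱx≡πʲx with m≤n⇒∃[o]m+o≡n i<j
  ... | d , refl = d , refl , sym (π^-injective i (begin
    π^ i x                  ≡⟨ πⁱx≡πʲx ⟩
    π^ (suc i + d) x        ≡⟨ cong (λ a → π^ a x) (+-suc i d) ⟨
    π^ (i + suc d) x        ≡⟨ π^-+ i (suc d) x ⟩
    π^ i (π^ (suc d) x)     ∎))
    where open ≡-Reasoning

  π^-returns : ∀ x → ∃[ d ] d < n × π^ (suc d) x ≡ x
  π^-returns x with pigeonhole (n<1+n n) (λ (i : Fin (suc n)) → π^ (toℕ i) x)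
  ... | i , j , i<j , πⁱx≡πʲx with π^-return i<j πⁱx≡πʲx
  ...   | d , i+d≡j , ret = d , ≤-trans (s≤s (m≤n+m d (toℕ i))) (subst (_≤ n) (sym i+d≡j) (s≤s⁻¹ (toℕ<n j))) , ret

  record MinimalReturn (x : Fin n) : Set where
    field
      k       : ℕ
      k<n     : k < n
      returns : π^ (suc k) x ≡ x
      minimal : ∀ {a} → a < k → π^ (suc a) x ≢ x

  -- opaque: letting unification unfold the search below exhausts memory
  opaque
    minimalReturn : ∀ x → MinimalReturn x
    minimalReturn x
      with ¬∀⟶∃¬-smallest n (λ i → π^ (suc (toℕ i)) x ≢ x) (λ i → ¬? (π^ (suc (toℕ i)) x ≟ᶠ x)) sometimes
      where
      sometimes : ¬ (∀ (i : Fin n) → π^ (suc (toℕ i)) x ≢ x)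
      sometimes never with π^-returns x
      ... | d , d<n , ret = never (fromℕ< d<n) (subst (λ a → π^ (suc a) x ≡ x) (sym (toℕ-fromℕ< d<n)) ret)
    ... | i , ¬¬ret , below = record
      { k       = toℕ i
      ; k<n     = toℕ<n i
      ; returns = decidable-stable (π^ (suc (toℕ i)) x ≟ᶠ x) ¬¬ret
      ; minimal = λ a<i → subst (λ b → π^ (suc b) x ≢ x) (trans (toℕ-inject (fromℕ< a<i)) (toℕ-fromℕ< a<i))
                                (below (fromℕ< a<i))
      }

  cycleFrom-orbit : ∀ x → cycleFrom π x ≡ applyUpTo (λ a → π^ a x) (suc (MinimalReturn.k (minimalReturn x)))
  cycleFrom-orbit x = cong (x ∷_) (walk-applyUpTo π (λ a → π^ (suc a) x) (λ _ → refl) k<n returns minimal)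
    where open MinimalReturn (minimalReturn x)

  ∈-cycleFrom⁻ : ∀ {x y} → y ∈ cycleFrom π x → ∃[ a ] y ≡ π^ a x
  ∈-cycleFrom⁻ {x} {y} y∈ with ∈-applyUpTo⁻ (λ a → π^ a x) (subst (y ∈_) (cycleFrom-orbit x) y∈)
  ... | a , _ , y≡ = a , y≡

  ∈-cycleFrom⁺ : ∀ a x → π^ a x ∈ cycleFrom π x
  ∈-cycleFrom⁺ a x = subst (π^ a x ∈_) (sym (cycleFrom-orbit x))
    (subst (_∈ applyUpTo (λ b → π^ b x) p) (sym π^a≡) (∈-applyUpTo⁺ (λ b → π^ b x) (m%n<n a p)))
    where
    open MinimalReturn (minimalReturn x)
    p = suc k
    π^a≡ : π^ a x ≡ π^ (a % p) x
    π^a≡ = begin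
      π^ a x                                ≡⟨ cong (λ b → π^ b x) (m≡m%n+[m/n]*n a p) ⟩
      π^ (a % p + (a / p) * p) x            ≡⟨ π^-+ (a % p) ((a / p) * p) x ⟩
      π^ (a % p) (π^ ((a / p) * p) x)       ≡⟨ cong (π^ (a % p)) (π^-* returns (a / p)) ⟩
      π^ (a % p) x                          ∎
      where open ≡-Reasoning

  cycleFrom-unique : ∀ x → Unique (cycleFrom π x)
  cycleFrom-unique x = subst Unique (sym (cycleFrom-orbit x)) (Uniqueₚ.applyUpTo⁺₁ (λ a → π^ a x) (suc k) distinct)
    where
    open MinimalReturn (minimalReturn x)
    distinct : ∀ {i j} → i < j → j < suc k → π^ i x ≢ π^ j x
    distinct i<j j≤k eq with π^-return i<j eq
    ... | d , refl , ret = minimal (<-≤-trans (s≤s (m≤n+m d _)) (s≤s⁻¹ j≤k)) ret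

  ∈-cycleFrom-sym : ∀ {x y} → y ∈ cycleFrom π x → x ∈ cycleFrom π y
  ∈-cycleFrom-sym {x} y∈ with ∈-cycleFrom⁻ y∈
  ... | b , refl = subst (_∈ cycleFrom π (π^ b x)) back (∈-cycleFrom⁺ (b * k) (π^ b x))
    where
    open MinimalReturn (minimalReturn x)
    back : π^ (b * k) (π^ b x) ≡ x
    back = begin
      π^ (b * k) (π^ b x)  ≡⟨ π^-+ (b * k) b x ⟨
      π^ (b * k + b) x     ≡⟨ cong (λ a → π^ a x) (trans (+-comm (b * k) b) (sym (*-suc b k))) ⟩
      π^ (b * suc k) x     ≡⟨ π^-* returns b ⟩
      x                    ∎
      where open ≡-Reasoning

  ∈-cycleFrom-trans : ∀ {x y z} → y ∈ cycleFrom π x → z ∈ cycleFrom π y → z ∈ cycleFrom π x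
  ∈-cycleFrom-trans {x} y∈ z∈ with ∈-cycleFrom⁻ y∈ | ∈-cycleFrom⁻ z∈
  ... | b , refl | a , refl = subst (_∈ cycleFrom π x) (π^-+ a b x) (∈-cycleFrom⁺ (a + b) x)

opaque
  lead : Vec (Fin n) n → Fin n → Fin n
  lead π x = argmin toℕ x (cycleFrom π x)

  lead-∈ : ∀ (π : Vec (Fin n) n) x → lead π x ∈ cycleFrom π x
  lead-∈ π x = argmin-all toℕ {P = _∈ cycleFrom π x} (here refl) (All.tabulate id)

  lead-minimal : ∀ (π : Vec (Fin n) n) {x y} → y ∈ cycleFrom π x → toℕ (lead π x) ≤ toℕ y
  lead-minimal π {x} y∈ = All.lookup (f[argmin]≤f[xs] {f = toℕ} x (cycleFrom π x)) y∈

lead-≐ : ∀ (π ρ : Vec (Fin n) n) {x y} → cycleFrom π x ∼[ set ] cycleFrom ρ y → lead π x ≡ lead ρ y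
lead-≐ π ρ {x} {y} eq = toℕ-injective (≤-antisym
  (lead-minimal π (Equivalence.from eq (lead-∈ ρ y)))
  (lead-minimal ρ (Equivalence.to eq (lead-∈ π x))))

isLeader⇔minimal : ∀ (π : Vec (Fin n) n) {x} → T (isLeader π x) ⇔ (∀ {y} → y ∈ cycleFrom π x → toℕ x ≤ toℕ y)
isLeader⇔minimal π {x} = mk⇔ to from
  where
  x≤? : Fin n → Bool
  x≤? y = ⌊ toℕ x ≤? toℕ y ⌋
  to : T (isLeader π x) → ∀ {y} → y ∈ cycleFrom π x → toℕ x ≤ toℕ y
  to t y∈ = toWitness (All.lookup (Allₚ.all⁺ x≤? (cycleFrom π x) t) y∈)
  from : (∀ {y} → y ∈ cycleFrom π x → toℕ x ≤ toℕ y) → T (isLeader π x)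
  from minimal = Allₚ.all⁻ x≤? (All.tabulate (λ y∈ → fromWitness (minimal y∈)))

isLeader⇔lead : ∀ (π : Vec (Fin n) n) {x} → T (isLeader π x) ⇔ lead π x ≡ x
isLeader⇔lead π {x} = mk⇔
  (λ t → toℕ-injective (≤-antisym (lead-minimal π (here refl)) (Equivalence.to (isLeader⇔minimal π) t (lead-∈ π x))))
  (λ lead≡x → Equivalence.from (isLeader⇔minimal π) (λ y∈ → subst (λ m → toℕ m ≤ toℕ _) lead≡x (lead-minimal π y∈)))

module _ {n} {π ρ : Vec (Fin n) n} {φ : Fin n → Fin n} (φ-injective : ∀ {x y} → φ x ≡ φ y → x ≡ y)
         (φ-conj : ∀ x → app ρ (φ x) ≡ φ (app π x)) where

  walk-conjugate : ∀ fuel s x → walk ρ fuel (φ s) (φ x) ≡ map φ (walk π fuel s x)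
  walk-conjugate zero       s x = refl
  walk-conjugate (suc fuel) s x with φ x ≟ᶠ φ s | x ≟ᶠ s
  ... | yes _     | yes _   = refl
  ... | yes φx≡φs | no x≢s  = contradiction (φ-injective φx≡φs) x≢s
  ... | no φx≢φs  | yes x≡s = contradiction (cong φ x≡s) φx≢φs
  ... | no _      | no _    =
    cong (φ x ∷_) (trans (cong (walk ρ fuel (φ s)) (φ-conj x)) (walk-conjugate fuel s (app π x)))

  cycleFrom-conjugate : ∀ x → cycleFrom ρ (φ x) ≡ map φ (cycleFrom π x)
  cycleFrom-conjugate x = cong (φ x ∷_) (trans (cong (walk ρ n (φ x)) (φ-conj x)) (walk-conjugate n x (app π x)))

-- Transforming the tails of all standard cycles

data Rooted {n} : List (Fin n) → Set where
  rooted : ∀ {m t} → Unique t → All (m Fin.<_) t → Rooted (m ∷ t)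

module CycleTransform {n} (M : List (Fin n) → Fin n → Fin n)
  (M-∈          : ∀ {t x} → Unique t → x ∈ t → M t x ∈ t)
  (M-involutive : ∀ {t x} → Unique t → x ∈ t → M t (M t x) ≡ x)
  (M-stable     : ∀ {t x} → Unique t → x ∈ t → M (map (M t) t) x ≡ M t x) where

  transformCycle : List (Fin n) → List (Fin n)
  transformCycle []      = []
  transformCycle (m ∷ t) = m ∷ map (M t) t

  cycleTail : Vec (Fin n) n → Fin n → List (Fin n)
  cycleTail π m = walk π n m (app π m)

  opaque
    φ : Vec (Fin n) n → Fin n → Fin n
    φ π x with x ≟ᶠ lead π x
    ... | yes _ = x
    ... | no  _ = M (cycleTail π (lead π x)) x

    φ-cases : ∀ π x {P : Fin n → Set} →
              (x ≡ lead π x → P x) → (x ≢ lead π x → P (M (cycleTail π (lead π x)) x)) → P (φ π x)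
    φ-cases π x on-leader off-leader with x ≟ᶠ lead π x
    ... | yes x≡lead = on-leader x≡lead
    ... | no  x≢lead = off-leader x≢lead

  φ-lead : ∀ π {x} → x ≡ lead π x → φ π x ≡ x
  φ-lead π {x} x≡lead = φ-cases π x {_≡ x} (λ _ → refl) (λ x≢lead → contradiction x≡lead x≢lead)

  φ-tail : ∀ π {x} → x ≢ lead π x → φ π x ≡ M (cycleTail π (lead π x)) x
  φ-tail π {x} x≢lead = φ-cases π x {_≡ M (cycleTail π (lead π x)) x}
    (λ x≡lead → contradiction x≡lead x≢lead) (λ _ → refl)

  ρ : Vec (Fin n) n → Vec (Fin n) n
  ρ π = Vec.tabulate (λ y → φ π (app π (φ π y)))

  module Properties (π : Vec (Fin n) n) (π-injective : ∀ {x y} → app π x ≡ app π y → x ≡ y) where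
    open Orbits π π-injective

    cycleFrom-≐ : ∀ {x y} → y ∈ cycleFrom π x → cycleFrom π y ∼[ set ] cycleFrom π x
    cycleFrom-≐ y∈ = mk⇔ (∈-cycleFrom-trans y∈) (∈-cycleFrom-trans (∈-cycleFrom-sym y∈))

    lead-cong : ∀ {x y} → y ∈ cycleFrom π x → lead π y ≡ lead π x
    lead-cong y∈ = lead-≐ π π (cycleFrom-≐ y∈)

    tail-unique : ∀ m → Unique (cycleTail π m)
    tail-unique m with cycleFrom-unique m
    ... | _ ∷ u = u

    ∉-tail : ∀ m → All (m ≢_) (cycleTail π m)
    ∉-tail m with cycleFrom-unique m
    ... | m∉ ∷ _ = m∉

    ∈-tail-lead : ∀ {x} → x ≢ lead π x → x ∈ cycleTail π (lead π x)
    ∈-tail-lead {x} x≢lead with ∈-cycleFrom-sym (lead-∈ π x)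
    ... | here x≡lead = contradiction x≡lead x≢lead
    ... | there x∈    = x∈

    φ-∈ : ∀ x → φ π x ∈ cycleFrom π x
    φ-∈ x = φ-cases π x {_∈ cycleFrom π x} (λ _ → here refl)
      (λ x≢lead → ∈-cycleFrom-trans (lead-∈ π x) (there (M-∈ (tail-unique _) (∈-tail-lead x≢lead))))

    lead-φ : ∀ x → lead π (φ π x) ≡ lead π x
    lead-φ x = lead-cong (φ-∈ x)

    φ-involutive : ∀ x → φ π (φ π x) ≡ x
    φ-involutive x = φ-cases π x {λ y → φ π y ≡ x} (φ-lead π) λ x≢lead →
      let t   = cycleTail π (lead π x)
          x∈t = ∈-tail-lead x≢lead
          lead-Mx : lead π (M t x) ≡ lead π x
          lead-Mx = trans (cong (lead π) (sym (φ-tail π x≢lead))) (lead-φ x)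
          Mx≢lead : M t x ≢ lead π (M t x)
          Mx≢lead eq = All.lookup (∉-tail (lead π x)) (M-∈ (tail-unique _) x∈t) (sym (trans eq lead-Mx))
      in begin
      φ π (M t x)                               ≡⟨ φ-tail π Mx≢lead ⟩
      M (cycleTail π (lead π (M t x))) (M t x)  ≡⟨ cong (λ m → M (cycleTail π m) (M t x)) lead-Mx ⟩
      M t (M t x)                               ≡⟨ M-involutive (tail-unique _) x∈t ⟩
      x                                         ∎
      where open ≡-Reasoning

    φ-injective : ∀ {x y} → φ π x ≡ φ π y → x ≡ y
    φ-injective {x} {y} eq = trans (sym (φ-involutive x)) (trans (cong (φ π) eq) (φ-involutive y))

    app-ρ : ∀ y → app (ρ π) y ≡ φ π (app π (φ π y))
    app-ρ = lookup∘tabulate _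

    ρ-conj : ∀ x → app (ρ π) (φ π x) ≡ φ π (app π x)
    ρ-conj x = trans (app-ρ (φ π x)) (cong (φ π ∘ app π) (φ-involutive x))

    ρ-isPerm : IsPerm (ρ π)
    ρ-isPerm = tabulate-isPerm _ (φ-injective ∘ π-injective ∘ φ-injective)

    cycleFrom-ρ : ∀ x → cycleFrom (ρ π) x ≡ map (φ π) (cycleFrom π (φ π x))
    cycleFrom-ρ x = trans (cong (cycleFrom (ρ π)) (sym (φ-involutive x)))
                          (cycleFrom-conjugate φ-injective ρ-conj (φ π x))

    cycleFrom-ρ-≐ : ∀ x → cycleFrom (ρ π) x ∼[ set ] cycleFrom π x
    cycleFrom-ρ-≐ x = mk⇔ to from
      where
      to : ∀ {z} → z ∈ cycleFrom (ρ π) x → z ∈ cycleFrom π x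
      to {z} z∈ with w , w∈ , z≡φw ← ∈-map⁻ (φ π) (subst (z ∈_) (cycleFrom-ρ x) z∈) =
        subst (_∈ cycleFrom π x) (sym z≡φw) (∈-cycleFrom-trans (∈-cycleFrom-trans (φ-∈ x) w∈) (φ-∈ w))
      from : ∀ {z} → z ∈ cycleFrom π x → z ∈ cycleFrom (ρ π) x
      from {z} z∈ = subst (z ∈_) (sym (cycleFrom-ρ x)) (subst (_∈ map (φ π) (cycleFrom π (φ π x))) (φ-involutive z)
        (∈-map⁺ (φ π) (Equivalence.from (cycleFrom-≐ (φ-∈ x)) (∈-cycleFrom-trans z∈ (φ-∈ z)))))

    isLeader-ρ : ∀ x → T (isLeader (ρ π) x) ⇔ T (isLeader π x)
    isLeader-ρ x = mk⇔
      (λ t → Equivalence.from (isLeader⇔minimal π) λ y∈ →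
        Equivalence.to (isLeader⇔minimal (ρ π)) t (Equivalence.from (cycleFrom-ρ-≐ x) y∈))
      (λ t → Equivalence.from (isLeader⇔minimal (ρ π)) λ y∈ →
        Equivalence.to (isLeader⇔minimal π) t (Equivalence.to (cycleFrom-ρ-≐ x) y∈))

    lead-ρ : ∀ x → lead (ρ π) x ≡ lead π x
    lead-ρ x = lead-≐ (ρ π) π (cycleFrom-ρ-≐ x)

    module Leader {m} (m-leader : T (isLeader π m)) where

      lead≡m : lead π m ≡ m
      lead≡m = Equivalence.to (isLeader⇔lead π) m-leader

      φ-on-tail : ∀ {w} → w ∈ cycleTail π m → φ π w ≡ M (cycleTail π m) w
      φ-on-tail {w} w∈ = trans (φ-tail π w≢lead) (cong (λ k → M (cycleTail π k) w) lead-w)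
        where
        lead-w : lead π w ≡ m
        lead-w = trans (lead-cong (there w∈)) lead≡m
        w≢lead : w ≢ lead π w
        w≢lead w≡lead = All.lookup (∉-tail m) w∈ (sym (trans w≡lead lead-w))

      cycleFrom-ρ-leader : cycleFrom (ρ π) m ≡ transformCycle (cycleFrom π m)
      cycleFrom-ρ-leader = begin
        cycleFrom (ρ π) m                               ≡⟨ cong (cycleFrom (ρ π)) φm≡m ⟨
        cycleFrom (ρ π) (φ π m)                         ≡⟨ cycleFrom-conjugate φ-injective ρ-conj m ⟩
        φ π m ∷ map (φ π) (cycleTail π m)               ≡⟨ cong₂ _∷_ φm≡m (map-cong-local (All.tabulate φ-on-tail)) ⟩
        m ∷ map (M (cycleTail π m)) (cycleTail π m)     ∎
        where
        open ≡-Reasoning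
        φm≡m = φ-lead π (sym lead≡m)

    standardCycles-ρ : standardCycles (ρ π) ≡ map transformCycle (standardCycles π)
    standardCycles-ρ = begin
      map (cycleFrom (ρ π)) (filterᵇ (isLeader (ρ π)) R)
        ≡⟨ cong (map _) (filter-≐ (T? ∘ isLeader (ρ π)) (T? ∘ isLeader π) leaders≐ R) ⟩
      map (cycleFrom (ρ π)) leaders
        ≡⟨ map-cong-local (All.map Leader.cycleFrom-ρ-leader (Allₚ.all-filter (T? ∘ isLeader π) R)) ⟩
      map (transformCycle ∘ cycleFrom π) leaders          ≡⟨ map-∘ leaders ⟩
      map transformCycle (standardCycles π)               ∎
      where
      open ≡-Reasoning
      R = reverse (allFin n)
      leaders = filterᵇ (isLeader π) R
      leaders≐ = (λ {x} → Equivalence.to (isLeader-ρ x)) , (λ {x} → Equivalence.from (isLeader-ρ x))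

    φ-ρ : ∀ x → φ (ρ π) x ≡ φ π x
    φ-ρ x = φ-cases π x {φ (ρ π) x ≡_} (λ x≡lead → φ-lead (ρ π) (trans x≡lead (sym (lead-ρ x)))) λ x≢lead →
      let m = lead π x
          t = cycleTail π m
          m-leader : T (isLeader π m)
          m-leader = Equivalence.from (isLeader⇔lead π) (lead-cong (lead-∈ π x))
          tail-ρ : cycleTail (ρ π) m ≡ map (M t) t
          tail-ρ = ∷-injectiveʳ (Leader.cycleFrom-ρ-leader m-leader)
      in begin
      φ (ρ π) x                             ≡⟨ φ-tail (ρ π) (λ x≡lead → x≢lead (trans x≡lead (lead-ρ x))) ⟩
      M (cycleTail (ρ π) (lead (ρ π) x)) x  ≡⟨ cong (λ k → M (cycleTail (ρ π) k) x) (lead-ρ x) ⟩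
      M (cycleTail (ρ π) m) x               ≡⟨ cong (λ t′ → M t′ x) tail-ρ ⟩
      M (map (M t) t) x                     ≡⟨ M-stable (tail-unique m) (∈-tail-lead x≢lead) ⟩
      M t x                                 ∎
      where open ≡-Reasoning

    ρ-involutive : ρ (ρ π) ≡ π
    ρ-involutive = trans (tabulate-cong pointwise) (tabulate∘lookup π)
      where
      pointwise : ∀ y → φ (ρ π) (app (ρ π) (φ (ρ π) y)) ≡ app π y
      pointwise y = begin
        φ (ρ π) (app (ρ π) (φ (ρ π) y))   ≡⟨ φ-ρ _ ⟩
        φ π (app (ρ π) (φ (ρ π) y))       ≡⟨ cong (φ π ∘ app (ρ π)) (φ-ρ y) ⟩
        φ π (app (ρ π) (φ π y))           ≡⟨ cong (φ π) (ρ-conj y) ⟩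
        φ π (φ π (app π y))               ≡⟨ φ-involutive (app π y) ⟩
        app π y                           ∎
        where open ≡-Reasoning

    standardCycles-rooted : All Rooted (standardCycles π)
    standardCycles-rooted = Allₚ.map⁺ (All.map rootedAt (Allₚ.all-filter (T? ∘ isLeader π) (reverse (allFin n))))
      where
      rootedAt : ∀ {m} → T (isLeader π m) → Rooted (cycleFrom π m)
      rootedAt {m} m-leader = rooted (tail-unique m) (All.zipWith (λ (m≢w , m≤w) → ≤∧≢⇒< m≤w m≢w)
        (∉-tail m , All.tabulate (λ w∈ → Equivalence.to (isLeader⇔minimal π) m-leader (there w∈))))

    cyc-ρ : cyc (ρ π) ≡ cyc π
    cyc-ρ = trans (cong length standardCycles-ρ) (length-map transformCycle (standardCycles π))

    occ-ρ : ∀ {σ τ} → (∀ {c} → Rooted c → windows σ (transformCycle c) ≡ windows τ c) → occ σ (ρ π) ≡ occ τ π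
    occ-ρ {σ} {τ} windows-transform = cong sum (begin
      map (windows σ) (standardCycles (ρ π))                      ≡⟨ cong (map (windows σ)) standardCycles-ρ ⟩
      map (windows σ) (map transformCycle (standardCycles π))     ≡⟨ map-∘ (standardCycles π) ⟨
      map (windows σ ∘ transformCycle) (standardCycles π)
        ≡⟨ map-cong-local (All.map windows-transform standardCycles-rooted) ⟩
      map (windows τ) (standardCycles π)                          ∎)
      where open ≡-Reasoning

  coeffF-transform : ∀ {σ τ} → (∀ {c} → Rooted c → windows σ (transformCycle c) ≡ windows τ c) →
                     ∀ k c → coeffF σ k c n ≡ coeffF τ k c n
  coeffF-transform {σ} {τ} windows-transform k c = count-involution ρ
    (λ {π} p → Properties.ρ-isPerm π (lookup-injective π p))
    (λ {π} p → Properties.ρ-involutive π (lookup-injective π p))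
    (λ π → (occ σ π ≟ⁿ k) ×-dec (cyc π ≟ⁿ c)) (λ π → (occ τ π ≟ⁿ k) ×-dec (cyc π ≟ⁿ c))
    λ {π} p → let open Properties π (lookup-injective π p) in mk⇔
      (λ (occ≡k , cyc≡c) → trans (sym (occ-ρ windows-transform)) occ≡k , trans (sym cyc-ρ) cyc≡c)
      (λ (occ≡k , cyc≡c) → trans (occ-ρ windows-transform) occ≡k , trans cyc-ρ cyc≡c)

-- Consecutive patterns

sameOrder : ℕ → ℕ → ℕ → ℕ → Bool
sameOrder x y u v = if x <ᵇ y then u <ᵇ v else not (u <ᵇ v)

orderIso-reverse : ∀ s₁ s₂ s₃ a b c → orderIso (pat s₁ s₂ s₃) a b c ≡ orderIso (pat s₃ s₂ s₁) c b a
orderIso-reverse s₁ s₂ s₃ a b c = ∧-reverse₆ (sameOrder a b s₁ s₂) (sameOrder a c s₁ s₃) (sameOrder b c s₂ s₃)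
  (sameOrder b a s₂ s₁) (sameOrder c a s₃ s₁) (sameOrder c b s₃ s₂)
  where
  ∧-reverse₆ : ∀ x₁ x₂ x₃ x₄ x₅ x₆ → x₁ ∧ x₂ ∧ x₃ ∧ x₄ ∧ x₅ ∧ x₆ ≡ x₆ ∧ x₅ ∧ x₄ ∧ x₃ ∧ x₂ ∧ x₁
  ∧-reverse₆ = solve 6 (λ x₁ x₂ x₃ x₄ x₅ x₆ → x₁ ⊕ x₂ ⊕ x₃ ⊕ x₄ ⊕ x₅ ⊕ x₆ ⊜ x₆ ⊕ x₅ ⊕ x₄ ⊕ x₃ ⊕ x₂ ⊕ x₁) refl

orderIso-least-first : ∀ {a b c} s₁ s₂ s₃ → a < b → a < c → (s₁ <ᵇ s₂) ∧ (s₁ <ᵇ s₃) ≡ false →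
                       orderIso (pat s₁ s₂ s₃) a b c ≡ false
orderIso-least-first {a} {b} {c} s₁ s₂ s₃ a<b a<c not-least
  rewrite Equivalence.to T-≡ (<⇒<ᵇ a<b) | Equivalence.to T-≡ (<⇒<ᵇ a<c) with s₁ <ᵇ s₂
... | false = refl
... | true  rewrite not-least = refl

isWindow : Pattern3 → Fin n → Fin n → Fin n → ℕ
isWindow σ a b c = if orderIso σ (toℕ a) (toℕ b) (toℕ c) then 1 else 0

windows-drop-least : ∀ s₁ s₂ s₃ → (s₁ <ᵇ s₂) ∧ (s₁ <ᵇ s₃) ≡ false →
                     ∀ {m : Fin n} {u} → All (m Fin.<_) u → windows (pat s₁ s₂ s₃) (m ∷ u) ≡ windows (pat s₁ s₂ s₃) u
windows-drop-least s₁ s₂ s₃ not-least []              = refl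
windows-drop-least s₁ s₂ s₃ not-least (_ ∷ [])        = refl
windows-drop-least s₁ s₂ s₃ not-least (m<a ∷ m<b ∷ _)
  rewrite orderIso-least-first s₁ s₂ s₃ m<a m<b not-least = refl

windows-map : ∀ σ τ (f : Fin n → Fin n) {u} → Unique u →
  (∀ {a b c} → a ∈ u → b ∈ u → c ∈ u → a ≢ b → a ≢ c → b ≢ c →
     orderIso σ (toℕ (f a)) (toℕ (f b)) (toℕ (f c)) ≡ orderIso τ (toℕ a) (toℕ b) (toℕ c)) →
  windows σ (map f u) ≡ windows τ u
windows-map σ τ f {[]}              _ _ = refl
windows-map σ τ f {_ ∷ []}          _ _ = refl
windows-map σ τ f {_ ∷ _ ∷ []}      _ _ = refl
windows-map σ τ f {a ∷ b ∷ c ∷ r} (a∉ ∷ b∉ ∷ u) same = cong₂ _+_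
  (cong (if_then 1 else 0) (same (here refl) (there (here refl)) (there (there (here refl)))
    (All.head a∉) (All.head (All.tail a∉)) (All.head b∉)))
  (windows-map σ τ f (b∉ ∷ u) (λ a∈ b∈ c∈ → same (there a∈) (there b∈) (there c∈)))

lastWindow : Pattern3 → List (Fin n) → Fin n → ℕ
lastWindow σ (a ∷ b ∷ [])           x = isWindow σ a b x
lastWindow σ (_ ∷ rest@(_ ∷ _ ∷ _)) x = lastWindow σ rest x
lastWindow σ _                      x = 0

windows-∷ʳ : ∀ σ (u : List (Fin n)) x → windows σ (u ∷ʳ x) ≡ windows σ u + lastWindow σ u x
windows-∷ʳ σ []                x = refl
windows-∷ʳ σ (_ ∷ [])          x = refl
windows-∷ʳ σ (a ∷ b ∷ [])      x = +-identityʳ _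
windows-∷ʳ σ (a ∷ b ∷ c ∷ r)   x = trans (cong (isWindow σ a b c +_) (windows-∷ʳ σ (b ∷ c ∷ r) x))
                                         (sym (+-assoc (isWindow σ a b c) _ _))

lastWindow-++ : ∀ σ (v : List (Fin n)) b a x → lastWindow σ (v ++ b ∷ a ∷ []) x ≡ isWindow σ b a x
lastWindow-++ σ []              b a x = refl
lastWindow-++ σ (_ ∷ [])        b a x = refl
lastWindow-++ σ (_ ∷ c ∷ [])    b a x = refl
lastWindow-++ σ (_ ∷ c ∷ d ∷ v) b a x = lastWindow-++ σ (c ∷ d ∷ v) b a x

windows-reverse : ∀ s₁ s₂ s₃ (u : List (Fin n)) → windows (pat s₁ s₂ s₃) (reverse u) ≡ windows (pat s₃ s₂ s₁) u
windows-reverse s₁ s₂ s₃ []              = refl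
windows-reverse s₁ s₂ s₃ (_ ∷ [])        = refl
windows-reverse s₁ s₂ s₃ (_ ∷ _ ∷ [])    = refl
windows-reverse s₁ s₂ s₃ (x ∷ a ∷ b ∷ r) = begin
  windows σ (reverse (x ∷ a ∷ b ∷ r))                           ≡⟨ cong (windows σ) (unfold-reverse x (a ∷ b ∷ r)) ⟩
  windows σ (reverse (a ∷ b ∷ r) ∷ʳ x)                          ≡⟨ windows-∷ʳ σ (reverse (a ∷ b ∷ r)) x ⟩
  windows σ (reverse (a ∷ b ∷ r)) + lastWindow σ (reverse (a ∷ b ∷ r)) x
    ≡⟨ cong₂ _+_ (windows-reverse s₁ s₂ s₃ (a ∷ b ∷ r)) last ⟩
  windows σʳ (a ∷ b ∷ r) + isWindow σ b a x
    ≡⟨ cong (windows σʳ (a ∷ b ∷ r) +_) (cong (if_then 1 else 0) (orderIso-reverse s₁ s₂ s₃ (toℕ b) (toℕ a) (toℕ x))) ⟩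
  windows σʳ (a ∷ b ∷ r) + isWindow σʳ x a b                    ≡⟨ +-comm (windows σʳ (a ∷ b ∷ r)) _ ⟩
  windows σʳ (x ∷ a ∷ b ∷ r)                                    ∎
  where
  open ≡-Reasoning
  σ  = pat s₁ s₂ s₃
  σʳ = pat s₃ s₂ s₁
  last : lastWindow σ (reverse (a ∷ b ∷ r)) x ≡ isWindow σ b a x
  last = trans (cong (λ v → lastWindow σ v x) (reverse-++ (a ∷ b ∷ []) r)) (lastWindow-++ σ (reverse r) b a x)

<ᵇ-true : ∀ {m n} → m < n → (m <ᵇ n) ≡ true
<ᵇ-true m<n = Equivalence.to T-≡ (<⇒<ᵇ m<n)

<ᵇ-false : ∀ {m n} → n ≤ m → (m <ᵇ n) ≡ false
<ᵇ-false {m} {n} n≤m with m <ᵇ n in m<n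
... | false = refl
... | true  = contradiction (<ᵇ⇒< m n (subst T (sym m<n) _)) (≤⇒≯ n≤m)

<ᵇ-flip : ∀ {x y} → x ≢ y → (y <ᵇ x) ≡ not (x <ᵇ y)
<ᵇ-flip {x} {y} x≢y with <-cmp x y
... | tri< x<y _ _ rewrite <ᵇ-false (<⇒≤ x<y) | <ᵇ-true x<y = refl
... | tri≈ _ x≡y _ = contradiction x≡y x≢y
... | tri> _ _ y<x rewrite <ᵇ-true y<x | <ᵇ-false (<⇒≤ y<x) = refl

orderIso-complement : ∀ {a b c a′ b′ c′} → a ≢ b → a ≢ c → b ≢ c →
  (a′ <ᵇ b′) ≡ (b <ᵇ a) → (b′ <ᵇ a′) ≡ (a <ᵇ b) → (a′ <ᵇ c′) ≡ (c <ᵇ a) → (c′ <ᵇ a′) ≡ (a <ᵇ c) →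
  (b′ <ᵇ c′) ≡ (c <ᵇ b) → (c′ <ᵇ b′) ≡ (b <ᵇ c) → orderIso p231 a′ b′ c′ ≡ orderIso p213 a b c
orderIso-complement {a} {b} {c} a≢b a≢c b≢c ab ba ac ca bc cb
  rewrite ab | ba | ac | ca | bc | cb | <ᵇ-flip a≢b | <ᵇ-flip a≢c | <ᵇ-flip b≢c
  with a <ᵇ b | a <ᵇ c | b <ᵇ c
... | true  | true  | true  = refl
... | true  | true  | false = refl
... | true  | false | true  = refl
... | true  | false | false = refl
... | false | true  | true  = refl
... | false | true  | false = refl
... | false | false | true  = refl
... | false | false | false = refl

windows-antitone : ∀ (f : Fin n → Fin n) {u} → Unique u →
  (∀ {x y} → x ∈ u → y ∈ u → x Fin.< y → f y Fin.< f x) → windows p231 (map f u) ≡ windows p213 u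
windows-antitone f {u} u-unique antitone = windows-map p231 p213 f u-unique
  λ {a} {b} {c} a∈ b∈ c∈ a≢b a≢c b≢c →
    orderIso-complement {toℕ a} {toℕ b} {toℕ c} {toℕ (f a)} {toℕ (f b)} {toℕ (f c)}
      (a≢b ∘ toℕ-injective) (a≢c ∘ toℕ-injective) (b≢c ∘ toℕ-injective)
      (flips a∈ b∈ a≢b) (flips b∈ a∈ (a≢b ∘ sym)) (flips a∈ c∈ a≢c) (flips c∈ a∈ (a≢c ∘ sym))
      (flips b∈ c∈ b≢c) (flips c∈ b∈ (b≢c ∘ sym))
  where
  flips : ∀ {x y} → x ∈ u → y ∈ u → x ≢ y → (toℕ (f x) <ᵇ toℕ (f y)) ≡ (toℕ y <ᵇ toℕ x)
  flips {x} {y} x∈ y∈ x≢y with Finₚ.<-cmp x y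
  ... | tri< x<y _ _ = trans (<ᵇ-false (<⇒≤ (antitone x∈ y∈ x<y))) (sym (<ᵇ-false (<⇒≤ x<y)))
  ... | tri≈ _ x≡y _ = contradiction x≡y x≢y
  ... | tri> _ _ y<x = trans (<ᵇ-true (antitone y∈ x∈ y<x)) (sym (<ᵇ-true y<x))

-- Reversal and complementation of the tails

module _ {n : ℕ} where

  module Reversal = CycleTransform (mirror (_≟ᶠ_ {n}))
    (λ u → mirror-∈ _≟ᶠ_ u)
    (λ u → mirror-involutive _≟ᶠ_ u)
    (λ {x = x} u x∈ → trans (cong (λ s → mirror _≟ᶠ_ s x) (map-mirror _≟ᶠ_ u)) (mirror-reverse _≟ᶠ_ u x∈))

  windows-reversal : ∀ {c} → Rooted c → windows p312 (Reversal.transformCycle c) ≡ windows p213 c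
  windows-reversal {m ∷ t} (rooted t-unique m<t) = begin
    windows p312 (m ∷ map (mirror _≟ᶠ_ t) t)  ≡⟨ cong (λ s → windows p312 (m ∷ s)) (map-mirror _≟ᶠ_ t-unique) ⟩
    windows p312 (m ∷ reverse t)              ≡⟨ windows-drop-least 3 1 2 refl
                                                   (All.tabulate (λ y∈ → All.lookup m<t (Anyₚ.reverse⁻ y∈))) ⟩
    windows p312 (reverse t)                  ≡⟨ windows-reverse 3 1 2 t ⟩
    windows p213 t                            ≡⟨ windows-drop-least 2 1 3 refl m<t ⟨
    windows p213 (m ∷ t)                      ∎
    where open ≡-Reasoning

module _ {n : ℕ} where
  open import Data.List.Membership.DecPropositional (_≟ᶠ_ {n}) using (_∈?_)

  ascending : List (Fin n) → List (Fin n)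
  ascending t = filter (_∈? t) (allFin n)

  ∈-ascending⇔ : ∀ {t x} → x ∈ ascending t ⇔ x ∈ t
  ∈-ascending⇔ {t} = mk⇔ (proj₂ ∘ ∈-filter⁻ (_∈? t) {xs = allFin n}) (∈-filter⁺ (_∈? t) (∈-allFin _))

  ascending-unique : ∀ t → Unique (ascending t)
  ascending-unique t = Uniqueₚ.filter⁺ (_∈? t) (Uniqueₚ.allFin⁺ n)

  ascending-increasing : ∀ t → AllPairs Fin._<_ (ascending t)
  ascending-increasing t = AllPairsₚ.filter⁺ (_∈? t) (AllPairsₚ.tabulate⁺-< id)

  complement : List (Fin n) → Fin n → Fin n
  complement t = mirror _≟ᶠ_ (ascending t)

  complement-∈ : ∀ {t x} → x ∈ t → complement t x ∈ t
  complement-∈ {t} x∈ =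
    Equivalence.to ∈-ascending⇔ (mirror-∈ _≟ᶠ_ (ascending-unique t) (Equivalence.from ∈-ascending⇔ x∈))

  complement-involutive : ∀ {t x} → x ∈ t → complement t (complement t x) ≡ x
  complement-involutive {t} x∈ = mirror-involutive _≟ᶠ_ (ascending-unique t) (Equivalence.from ∈-ascending⇔ x∈)

  complement-antitone : ∀ {t x y} → x ∈ t → y ∈ t → x Fin.< y → complement t y Fin.< complement t x
  complement-antitone {t} x∈ y∈ = mirror-antitone _≟ᶠ_ Finₚ.<-asym (ascending-increasing t)
    (Equivalence.from ∈-ascending⇔ x∈) (Equivalence.from ∈-ascending⇔ y∈)

  complement-stable : ∀ {t x} → complement (map (complement t) t) x ≡ complement t x
  complement-stable {t} {x} =
    cong (λ s → mirror _≟ᶠ_ s x) (filter-≐ (_∈? map (complement t) t) (_∈? t) same-members (allFin n))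
    where
    image⊆ : ∀ {y} → y ∈ map (complement t) t → y ∈ t
    image⊆ y∈ with z , z∈ , refl ← ∈-map⁻ (complement t) y∈ = complement-∈ z∈
    image⊇ : ∀ {y} → y ∈ t → y ∈ map (complement t) t
    image⊇ y∈ = subst (_∈ map (complement t) t) (complement-involutive y∈) (∈-map⁺ (complement t) (complement-∈ y∈))
    same-members : (_∈ map (complement t) t) ≐ (_∈ t)
    same-members = image⊆ , image⊇

  module Complementation = CycleTransform complement
    (λ _ → complement-∈) (λ _ → complement-involutive) (λ _ _ → complement-stable)

  windows-complementation : ∀ {c} → Rooted c → windows p231 (Complementation.transformCycle c) ≡ windows p213 c
  windows-complementation {m ∷ t} (rooted t-unique m<t) = begin
    windows p231 (m ∷ map (complement t) t)  ≡⟨ windows-drop-least 2 3 1 refl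
                                                  (Allₚ.map⁺ (All.tabulate (λ y∈ → All.lookup m<t (complement-∈ y∈)))) ⟩
    windows p231 (map (complement t) t)      ≡⟨ windows-antitone (complement t) t-unique complement-antitone ⟩
    windows p213 t                           ≡⟨ windows-drop-least 2 1 3 refl m<t ⟨
    windows p213 (m ∷ t)                     ∎
    where open ≡-Reasoning

mainTheorem4 : (p213 ≡F p231) × (p231 ≡F p312)
mainTheorem4 = (λ k c n → sym (complementation k c n))
             , (λ k c n → trans (complementation k c n) (sym (reversal k c n)))
  where
  complementation : p231 ≡F p213
  complementation k c n = Complementation.coeffF-transform {n = n} windows-complementation k c
  reversal : p312 ≡F p213
  reversal k c n = Reversal.coeffF-transform {n = n} windows-reversal k c
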